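{- Let $n\ge1$, $x,y$ coprime with $1\le x<y$, and consider the rotor multigraph $P^{x,y}_n$. For any integer $v\ge0$, we have $v\in g(\mathcal{R})$ if and only if the word $c[v]=(c_0,c_1,\dots,c_{n+1})$ belongs to the language described by the regular expression \[ e_d=\{0,\dots,y-1\}^*\cdot 0\cdot\{1,\dots,x\}^*\cdot 0 .\]
   Context: $P^{x,y}_n$ has vertices $u_0,\dots,u_{n+1}$; $u_0,u_{n+1}$ are sinks and $V_0=\{u_1,\dots,u_n\}$. For $1\le k\le n$, $u_k$ has outgoing arcs $a^k_0,\dots,a^k_{x+y-1}$, with $a^k_i$ going to $u_{k+1}$ for $0\le i\le x-1$ and to $u_{k-1}$ for $x\le i\le x+y-1$. A rotor configuration assigns to each $u\in V_0$ an outgoing arc $\rho(u)$; $\mathcal{R}$ is their set. With $h(u_0)=0$, $h(u_k)=\sum_{i=0}^{k-1}x^{n-i}y^i$, define $g(a^k_j)=\sum_{i=0}^{j-1}\big(h(\mathrm{head}(a^k_i))-h(u_k)\big)$, $g(\rho)=\sum_{u\in V_0}g(\rho(u))$, and $g(\mathcal{R})=\{g(\rho):\rho\in\mathcal{R}\}$. Let $d_k=x^{n-k}y^k$ ($0\le k\le n+1$). For an integer $v\ge0$, $c[v]=(c_0,\dots,c_{n+1})$ is its stable decomposition: the unique tuple with $v=\sum_{k=0}^{n+1}c_kd_k$, $c_k\in\{0,\dots,y-1\}$ for $0\le k\le n$ and $c_{n+1}\in x\mathbb{Z}$; it is viewed as a word of length $n+2$ over the alphabet $\mathbb{Z}$.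 In $e_d$, a set of integers denotes any single letter from that set, $\cdot$ is concatenation and $^*$ is Kleene star. -}

module Defs where

open import Data.Nat as ℕ using (ℕ; zero; suc; _∸_; _<?_)
open import Data.Integer as ℤ using (ℤ; +_; _+_; _-_; _*_; _≤_; 0ℤ)
open import Data.Integer.Properties using (≤-preorder)
open import Data.Fin using (Fin; toℕ; fromℕ; inject₁) renaming (zero to fz; suc to fs)
open import Data.Vec using (Vec; lookup; toList)
open import Data.List using (List; []; _∷_)
open import Data.Product using (Σ; ∃; _×_; _,_)
open import Data.Bool using (if_then_else_)
open import Relation.Nullary.Decidable using (⌊_⌋)
open import Relation.Binary.PropositionalEquality using (_≡_)
import Text.Regex.Base as RB

module Regex = RB ≤-preorder

sumTo : ℕ → (ℕ → ℤ) → ℤ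
sumTo zero    f = 0ℤ
sumTo (suc k) f = sumTo k f + f k

sumFin : (m : ℕ) → (Fin m → ℤ) → ℤ
sumFin zero    f = 0ℤ
sumFin (suc m) f = f fz + sumFin m (λ i → f (fs i))

module RotorPath (n x y : ℕ) where

  d : ℕ → ℤ
  d k = + (x ℕ.^ (n ∸ k) ℕ.* y ℕ.^ k)

  h : ℕ → ℤ
  h k = sumTo k (λ i → + (x ℕ.^ (n ∸ i) ℕ.* y ℕ.^ i))

  -- index of head(a^k_i): u_{k+1} if i < x, u_{k-1} otherwise (k ≥ 1)
  headIdx : ℕ → ℕ → ℕ
  headIdx k i = if ⌊ i <? x ⌋ then suc k else k ∸ 1

  gArc : ℕ → ℕ → ℤ
  gArc k j = sumTo j (λ i → h (headIdx k i) - h k)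

  -- rotor configuration: ρ(u_{k+1}) = a^{k+1}_{ρ k}, for k : Fin n
  RotorConfig : Set
  RotorConfig = Fin n → Fin (x ℕ.+ y)

  gRotor : RotorConfig → ℤ
  gRotor ρ = sumFin n (λ k → gArc (suc (toℕ k)) (toℕ (ρ k)))

  InGR : ℤ → Set
  InGR v = ∃ λ (ρ : RotorConfig) → gRotor ρ ≡ v

  -- c is the stable decomposition of v:
  --   c_k ∈ {0,…,y-1} for 0 ≤ k ≤ n, c_{n+1} = x·m ∈ xℤ, and
  --   v = Σ_{k=0}^{n} c_k d_k + c_{n+1} d_{n+1}, where c_{n+1} d_{n+1} = m·y^{n+1}
  IsStableDecomp : ℤ → Vec ℤ (suc (suc n)) → Set
  IsStableDecomp v c =
    ((k : Fin (suc n)) → (0ℤ ≤ lookup c (inject₁ k)) × (lookup c (inject₁ k) ≤ + (y ∸ 1)))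
    × (∃ λ (m : ℤ) → (lookup c (fromℕ (suc n)) ≡ + x * m)
        × (v ≡ sumFin (suc n) (λ k → lookup c (inject₁ k) * d (toℕ k)) + m * + (y ℕ.^ suc n)))

  e_d : Regex.Exp
  e_d = Regex.Exp._∙_ (Regex.Exp._⋆ (Regex.Exp.[_] (Regex.Range._─_ 0ℤ (+ (y ∸ 1)) ∷ [])))
          (Regex.Exp._∙_ (Regex.Exp.[_] (Regex.Range.[_] 0ℤ ∷ []))
            (Regex.Exp._∙_ (Regex.Exp._⋆ (Regex.Exp.[_] (Regex.Range._─_ (+ 1) (+ x) ∷ [])))
              (Regex.Exp.[_] (Regex.Range.[_] 0ℤ ∷ []))))

  InLanguage : Vec ℤ (suc (suc n)) → Set
  InLanguage c = toList c Regex.∈ e_d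

-- The rotor at u_{k+1} contributes either f·d_{k+1} with f ≤ x (arcs a_0, …, a_x) or
-- b·d_k with 0 < b < y (arcs a_{x+1}, …, a_{x+y-1}), because x·d_{k+1} = y·d_k.
-- Collecting these contributions level by level and carrying y·d_k into x·d_{k+1}
-- turns g(ρ) into a digit word with last letter 0. The amount pending at a level
-- never exceeds x, and a digit above x arises only when nothing is carried on, so
-- the word lies in {0,…,y-1}*·0·{1,…,x}*·0. Conversely, a word A·0·B·0 of this shape
-- is g of the configuration pointing down with weights A below the separating 0 and
-- up with weights B above it. As x and y are coprime, the stable decomposition is
-- unique, so in both directions the word is c[v].

module Submission where

open import Defs
open import Data.Nat using (ℕ; _≤_; _<_)
import Data.Nat
open import Data.Nat.Coprimality using (Coprime)
open import Data.Integer using (ℤ; +_)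
open import Data.Vec using (Vec)
open import Function.Bundles using (_⇔_)

open import Data.Nat as ℕ using (zero; suc; _∸_; _^_; z≤n; s≤s; _≤?_; _<?_)
import Data.Nat.Properties as ℕₚ
import Data.Nat.Tactic.RingSolver as ℕ-Solver
open import Data.Nat.Divisibility using (_∣_; divides; >⇒∤)
import Data.Nat.Coprimality as Coprimality
open import Data.Integer as ℤ using (0ℤ; _+_; _*_; _-_; -_; ∣_∣)
import Data.Integer.Properties as ℤₚ
open import Algebra.Bundles using (AbelianGroup)
open import Algebra.Properties.Group (AbelianGroup.group ℤₚ.+-0-abelianGroup) using (∙-cancelˡ)
open import Data.Integer.Tactic.RingSolver using (solve-∀)
open import Data.Fin using (Fin; toℕ; fromℕ; fromℕ<; inject₁) renaming (zero to fz; suc to fs)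
import Data.Fin.Properties as Finₚ
open import Data.Vec using ([]; _∷_; _∷ʳ_; initLast; lookup; toList)
import Data.Vec.Properties as Vecₚ
open import Data.List as List using (List; []; _∷_; _++_; length; map; tabulate)
import Data.List.Properties as Listₚ
open import Data.List.Relation.Unary.All as All using (All; []; _∷_)
import Data.List.Relation.Unary.All.Properties as Allₚ
open import Data.List.Relation.Unary.Any using (here)
open import Data.List.Relation.Ternary.Appending.Propositional using (break)
  renaming (_++_ to _++ᴬ_)
open import Data.Product using (∃; ∃₂; _×_; _,_)
open import Data.Sum using (_⊎_; inj₁; inj₂)
open import Function using (_∘_)
open import Function.Bundles using (mk⇔)
import Function.Properties.Equivalence as Equivalence
open import Data.Product.Function.NonDependent.Propositional using (_×-⇔_)
open import Level using (0ℓ)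
open import Relation.Nullary using (yes; no; contradiction)
open import Relation.Binary.PropositionalEquality
import Relation.Binary.Reasoning.Setoid as SetoidReasoning

sumFrom : {A : Set} → (ℕ → A → ℤ) → ℕ → List A → ℤ
sumFrom G k []       = 0ℤ
sumFrom G k (a ∷ as) = G k a + sumFrom G (suc k) as

sumFrom-shift : ∀ {A : Set} (G : ℕ → A → ℤ) k as →
                sumFrom (G ∘ suc) k as ≡ sumFrom G (suc k) as
sumFrom-shift G k []       = refl
sumFrom-shift G k (a ∷ as) = cong (_+_ (G (suc k) a)) (sumFrom-shift G (suc k) as)

sumFin-cong : ∀ m {f g : Fin m → ℤ} → (∀ i → f i ≡ g i) → sumFin m f ≡ sumFin m g
sumFin-cong zero    f≡g = refl
sumFin-cong (suc m) f≡g = cong₂ _+_ (f≡g fz) (sumFin-cong m (f≡g ∘ fs))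

sumFin-tabulate : ∀ {A : Set} m (G : ℕ → A → ℤ) (f : Fin m → A) →
                  sumFin m (λ i → G (toℕ i) (f i)) ≡ sumFrom G 0 (tabulate f)
sumFin-tabulate zero    G f = refl
sumFin-tabulate (suc m) G f = cong (_+_ (G 0 (f fz)))
  (trans (sumFin-tabulate m (G ∘ suc) (f ∘ fs)) (sumFrom-shift G 0 (tabulate (f ∘ fs))))

tabulate-toℕ-surjective : ∀ {b m} (js : List ℕ) → All (_< b) js → length js ≡ m →
                          ∃ λ (ρ : Fin m → Fin b) → tabulate (toℕ ∘ ρ) ≡ js
tabulate-toℕ-surjective []       []          refl = (λ ()) , refl
tabulate-toℕ-surjective (j ∷ js) (j<b ∷ js<b) refl
  with ρ , tabulate≡js ← tabulate-toℕ-surjective js js<b refl =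
  (λ { fz → fromℕ< j<b ; (fs i) → ρ i }) , cong₂ _∷_ (Finₚ.toℕ-fromℕ< j<b) tabulate≡js

toList≡tabulate-lookup : ∀ {A : Set} {m} (w : Vec A m) → toList w ≡ tabulate (lookup w)
toList≡tabulate-lookup []      = refl
toList≡tabulate-lookup (a ∷ w) = cong (a ∷_) (toList≡tabulate-lookup w)

lookup-∷ʳ-inject₁ : ∀ {A : Set} {m} (w : Vec A m) a (k : Fin m) →
                    lookup (w ∷ʳ a) (inject₁ k) ≡ lookup w k
lookup-∷ʳ-inject₁ (b ∷ w) a fz     = refl
lookup-∷ʳ-inject₁ (b ∷ w) a (fs k) = lookup-∷ʳ-inject₁ w a k

lookup-∷ʳ-fromℕ : ∀ {A : Set} {m} (w : Vec A m) a → lookup (w ∷ʳ a) (fromℕ m) ≡ a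
lookup-∷ʳ-fromℕ []      a = refl
lookup-∷ʳ-fromℕ (b ∷ w) a = lookup-∷ʳ-fromℕ w a

<⇒≤∸1 : ∀ {m n} → m < n → m ≤ n ∸ 1
<⇒≤∸1 (s≤s m≤n) = m≤n

coprime-divisor-^ : ∀ {d m} N {k} → Coprime d m → d ∣ m ^ N ℕ.* k → d ∣ k
coprime-divisor-^ {d} zero    {k} d⊥m d∣k = subst (d ∣_) (ℕₚ.+-identityʳ k) d∣k
coprime-divisor-^ {d} {m} (suc N) {k} d⊥m d∣ = coprime-divisor-^ N d⊥m
  (Coprimality.coprime-divisor d⊥m (subst (d ∣_) (ℕₚ.*-assoc m (m ^ N) k) d∣))

Digit : ℕ → ℤ → Set
Digit y a = 0ℤ ℤ.≤ a × a ℤ.≤ + (y ∸ 1)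

Low : ℕ → ℤ → Set
Low x a = + 1 ℤ.≤ a × a ℤ.≤ + x

digit-< : ∀ {y d} → d < y → Digit y (+ d)
digit-< d<y = ℤ.+≤+ z≤n , ℤ.+≤+ (<⇒≤∸1 d<y)

∣digit∣<base : ∀ {y a} → 0 < y → Digit y a → ∣ a ∣ < y
∣digit∣<base {suc y} _ (ℤ.+≤+ _ , ℤ.+≤+ a≤y) = s≤s a≤y

∣digit-difference∣<base : ∀ {y a a'} → 0 < y → Digit y a → Digit y a' → ∣ a - a' ∣ < y
∣digit-difference∣<base {y} {+ p} {+ q} 0<y dp dq = begin-strict
  ∣ + p - + q ∣ ≡⟨ cong ∣_∣ (ℤₚ.[+m]-[+n]≡m⊖n p q) ⟩
  ∣ p ℤ.⊖ q ∣   ≤⟨ ℤₚ.∣m⊝n∣≤m⊔n p q ⟩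
  p ℕ.⊔ q       <⟨ ℕₚ.⊔-pres-<m (∣digit∣<base 0<y dp) (∣digit∣<base 0<y dq) ⟩
  y             ∎
  where open ℕₚ.≤-Reasoning

regroup : ∀ p q r s D M → p + q ≡ r + s → p * D + (q * D + M) ≡ r * D + (s * D + M)
regroup p q r s D M p+q≡r+s = begin
  p * D + (q * D + M) ≡⟨ distrib p q D M ⟩
  (p + q) * D + M     ≡⟨ cong (λ e → e * D + M) p+q≡r+s ⟩
  (r + s) * D + M     ≡⟨ distrib r s D M ⟨
  r * D + (s * D + M) ∎
  where
  open ≡-Reasoning
  distrib : ∀ p q D M → p * D + (q * D + M) ≡ (p + q) * D + M
  distrib = solve-∀

horner : (x y : ℕ) → List ℤ → ℤ → ℤ
horner x y []      m = m
horner x y (a ∷ w) m = a * + (x ^ length w) + + y * horner x y w m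

module _ {x y : ℕ} (y⊥x : Coprime y x) (0<y : 0 < y) where

  leading-digit-unique : ∀ N {a a' T T'} → Digit y a → Digit y a' →
    a * + (x ^ N) + + y * T ≡ a' * + (x ^ N) + + y * T' → a ≡ a' × T ≡ T'
  leading-digit-unique N {a} {a'} {T} {T'} da da' eq = a≡a' , T≡T'
    where
    X = + (x ^ N)
    gap : (a - a') * X ≡ + y * (T' - T)
    gap = begin
      (a - a') * X                      ≡⟨ l₁ a a' X (+ y) T ⟩
      (a * X + + y * T) - (a' * X + + y * T) ≡⟨ cong (_- (a' * X + + y * T)) eq ⟩
      (a' * X + + y * T') - (a' * X + + y * T) ≡⟨ l₂ a' X (+ y) T T' ⟩
      + y * (T' - T)                    ∎
      where
      open ≡-Reasoning
      l₁ : ∀ a a' X y T → (a - a') * X ≡ (a * X + y * T) - (a' * X + y * T)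
      l₁ = solve-∀
      l₂ : ∀ a' X y T T' → (a' * X + y * T') - (a' * X + y * T) ≡ y * (T' - T)
      l₂ = solve-∀
    y∣gap : y ∣ x ^ N ℕ.* ∣ a - a' ∣
    y∣gap = divides ∣ T' - T ∣ (begin
      x ^ N ℕ.* ∣ a - a' ∣   ≡⟨ ℕₚ.*-comm (x ^ N) _ ⟩
      ∣ a - a' ∣ ℕ.* x ^ N   ≡⟨ ℤₚ.abs-* (a - a') X ⟨
      ∣ (a - a') * X ∣       ≡⟨ cong ∣_∣ gap ⟩
      ∣ + y * (T' - T) ∣     ≡⟨ ℤₚ.abs-* (+ y) (T' - T) ⟩
      y ℕ.* ∣ T' - T ∣       ≡⟨ ℕₚ.*-comm y _ ⟩
      ∣ T' - T ∣ ℕ.* y       ∎)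
      where open ≡-Reasoning
    a≡a' : a ≡ a'
    a≡a' with ∣ a - a' ∣ in eq-gap | coprime-divisor-^ N y⊥x y∣gap
    ... | zero  | _   = ℤₚ.i-j≡0⇒i≡j a a' (ℤₚ.∣i∣≡0⇒i≡0 eq-gap)
    ... | suc g | y∣g = contradiction y∣g (>⇒∤ (subst (_< y) eq-gap (∣digit-difference∣<base 0<y da da')))
    T≡T' : T ≡ T'
    T≡T' = ℤₚ.*-cancelˡ-≡ (+ y) T T' {{ℕ.>-nonZero 0<y}}
      (∙-cancelˡ (a' * X) _ _ (trans (cong (λ b → b * X + + y * T) (sym a≡a')) eq))

  horner-injective : ∀ w w' {m m'} → length w ≡ length w' →
    All (Digit y) w → All (Digit y) w' → horner x y w m ≡ horner x y w' m' → w ≡ w' × m ≡ m'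
  horner-injective []      []        refl []        []          eq = refl , eq
  horner-injective (a ∷ w) (a' ∷ w') len  (da ∷ dw) (da' ∷ dw') eq
    with a≡a' , T≡T' ← leading-digit-unique (length w) da da'
                         (subst (λ L → _ ≡ a' * + (x ^ L) + _) (sym (ℕₚ.suc-injective len)) eq)
    with w≡w' , m≡m' ← horner-injective w w' (ℕₚ.suc-injective len) dw dw' T≡T'
    = cong₂ _∷_ a≡a' w≡w' , m≡m'

data Move : Set where
  fwd bwd : ℕ → Move

module Words {x y : ℕ} (x<y : x < y) where

  0<y : 0 < y
  0<y = ℕₚ.≤-<-trans z≤n x<y

  Admissible : List ℤ → Set
  Admissible w = ∃₂ λ A B → w ≡ A ++ 0ℤ ∷ B × All (Digit y) A × All (Low x) B

  Tail : List ℤ → Set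
  Tail w = All (Low x) w ⊎ Admissible w

  low⇒digit : ∀ {a} → Low x a → Digit y a
  low⇒digit (1≤a , a≤x) = ℤₚ.≤-trans (ℤ.+≤+ z≤n) 1≤a , ℤₚ.≤-trans a≤x (ℤ.+≤+ (<⇒≤∸1 x<y))

  admissible⇒digits : ∀ {w} → Admissible w → All (Digit y) w
  admissible⇒digits (A , B , refl , dA , lB) =
    Allₚ.++⁺ dA (digit-< 0<y ∷ All.map low⇒digit lB)

  digit∷-admissible : ∀ {a w} → Digit y a → Admissible w → Admissible (a ∷ w)
  digit∷-admissible {a} da (A , B , refl , dA , lB) = a ∷ A , B , refl , da ∷ dA , lB

  zero∷-tail : ∀ {w} → Tail w → Admissible (0ℤ ∷ w)
  zero∷-tail {w} (inj₁ lw) = [] , w , refl , [] , lw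
  zero∷-tail     (inj₂ aw) = digit∷-admissible (digit-< 0<y) aw

  small∷-tail : ∀ {u w} → u ≤ x → Tail w → Tail (+ u ∷ w)
  small∷-tail {zero}  _   t         = inj₂ (zero∷-tail t)
  small∷-tail {suc u} u<x (inj₁ lw) = inj₁ ((ℤ.+≤+ (s≤s z≤n) , ℤ.+≤+ u<x) ∷ lw)
  small∷-tail {suc u} u<x (inj₂ aw) = inj₂ (digit∷-admissible (digit-< (ℕₚ.≤-<-trans u<x x<y)) aw)

  ValidMove : Move → Set
  ValidMove (fwd f) = f ≤ x
  ValidMove (bwd b) = b < y

  -- Carry normalisation: u is the pending coefficient of the current level; a level
  -- overflowing y is reduced by y and passes x to the next level (x d (k+1) = y d k).
  digits : ℕ → List Move → List ℤ
  digits u []           = + u ∷ []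
  digits u (fwd f ∷ ms) = + u ∷ digits f ms
  digits u (bwd b ∷ ms) with y ≤? u ℕ.+ b
  ... | yes _ = + (u ℕ.+ b ∸ y) ∷ digits x ms
  ... | no  _ = + (u ℕ.+ b) ∷ digits 0 ms

  length-digits : ∀ u ms → length (digits u ms) ≡ suc (length ms)
  length-digits u []           = refl
  length-digits u (fwd f ∷ ms) = cong suc (length-digits f ms)
  length-digits u (bwd b ∷ ms) with y ≤? u ℕ.+ b
  ... | yes _ = cong suc (length-digits x ms)
  ... | no  _ = cong suc (length-digits 0 ms)

  carried-digit≤x : ∀ {u b} → u ≤ x → b < y → u ℕ.+ b ∸ y ≤ x
  carried-digit≤x {u} {b} u≤x b<y = ℕₚ.m≤n+o⇒m∸n≤o (u ℕ.+ b) y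
    (subst (u ℕ.+ b ≤_) (ℕₚ.+-comm x y) (ℕₚ.+-mono-≤ u≤x (ℕₚ.<⇒≤ b<y)))

  -- The pending amount stays ≤ x; a digit above x is produced only without carry,
  -- and then nothing is pending, so the rest of the word is again admissible.
  mutual
    digits-admissible : ∀ ms → All ValidMove ms → Admissible (digits 0 ms)
    digits-admissible []           []          = [] , [] , refl , [] , []
    digits-admissible (fwd f ∷ ms) (f≤x ∷ vms) = zero∷-tail (digits-tail f ms f≤x vms)
    digits-admissible (bwd b ∷ ms) (b<y ∷ vms) with y ≤? b
    ... | yes y≤b = contradiction y≤b (ℕₚ.<⇒≱ b<y)
    ... | no  _   = digit∷-admissible (digit-< b<y) (digits-admissible ms vms)

    digits-tail : ∀ u ms → u ≤ x → All ValidMove ms → Tail (digits u ms)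
    digits-tail u []           u≤x []          = small∷-tail u≤x (inj₁ [])
    digits-tail u (fwd f ∷ ms) u≤x (f≤x ∷ vms) = small∷-tail u≤x (digits-tail f ms f≤x vms)
    digits-tail u (bwd b ∷ ms) u≤x (b<y ∷ vms) with y ≤? u ℕ.+ b
    ... | yes _   = small∷-tail (carried-digit≤x u≤x b<y) (digits-tail x ms ℕₚ.≤-refl vms)
    ... | no  u+b≱y =
      inj₂ (digit∷-admissible (digit-< (ℕₚ.≰⇒> u+b≱y)) (digits-admissible ms vms))

  module _ (n : ℕ) where
    open RotorPath n x y using (e_d)
    open Regex

    ⋆-range⇒All : ∀ {lb ub w} → w ∈ [ (lb ─ ub) ∷ [] ] ⋆ → All (λ a → lb ℤ.≤ a × a ℤ.≤ ub) w
    ⋆-range⇒All (star (sum (inj₁ ε))) = []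
    ⋆-range⇒All (star (sum (inj₂ (prod split ([ here (lb≤a ─ a≤ub) ]) rest)))) with refl ← break split =
      (lb≤a , a≤ub) ∷ ⋆-range⇒All rest

    All⇒⋆-range : ∀ {lb ub w} → All (λ a → lb ℤ.≤ a × a ℤ.≤ ub) w → w ∈ [ (lb ─ ub) ∷ [] ] ⋆
    All⇒⋆-range []                            = star (sum (inj₁ ε))
    All⇒⋆-range {w = a ∷ w} ((lb≤a , a≤ub) ∷ as) =
      star (sum (inj₂ (prod ((a ∷ []) ++ᴬ w) ([ here (lb≤a ─ a≤ub) ]) (All⇒⋆-range as))))

    ∈-zero : ∀ {w} → w ∈ [ Range.[ 0ℤ ] ∷ [] ] → w ≡ 0ℤ ∷ []
    ∈-zero ([ here ([ refl ]) ]) = refl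

    ∷ʳ-∈e_d⇔ : ∀ w a → (w List.∷ʳ a) ∈ e_d ⇔ (a ≡ 0ℤ × Admissible w)
    ∷ʳ-∈e_d⇔ w a = mk⇔ to from
      where
      to : (w List.∷ʳ a) ∈ e_d → a ≡ 0ℤ × Admissible w
      to (prod {v = A} split₁ A∈ (prod split₂ z₁ (prod {v = B} split₃ B∈ z₂)))
        with refl ← ∈-zero z₁ | refl ← ∈-zero z₂ | refl ← break split₃ | refl ← break split₂
        with w≡ , a≡0 ← Listₚ.∷ʳ-injective w (A ++ 0ℤ ∷ B)
               (trans (sym (break split₁)) (sym (Listₚ.++-assoc A (0ℤ ∷ B) (0ℤ ∷ []))))
        = a≡0 , A , B , w≡ , ⋆-range⇒All A∈ , ⋆-range⇒All B∈
      from : a ≡ 0ℤ × Admissible w → (w List.∷ʳ a) ∈ e_d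
      from (refl , A , B , refl , dA , lB) =
        subst (_∈ e_d) (sym (Listₚ.++-assoc A (0ℤ ∷ B) (0ℤ ∷ [])))
          (prod (A ++ᴬ _) (All⇒⋆-range dA)
            (prod ((0ℤ ∷ []) ++ᴬ _) ([ here ([ refl ]) ])
              (prod (B ++ᴬ _) (All⇒⋆-range lB) ([ here ([ refl ]) ]))))

module Rotor (n x y : ℕ) (x<y : x < y) where
  open RotorPath n x y
  open Words x<y

  x*d[1+k]≡y*d[k] : ∀ {k} → k < n → + x * d (suc k) ≡ + y * d k
  x*d[1+k]≡y*d[k] {k} k<n = begin
    + x * d (suc k)                                 ≡⟨ ℤₚ.pos-* x _ ⟨
    + (x ℕ.* (x ^ e ℕ.* y ^ suc k))                 ≡⟨ cong +_ (exchange x y (x ^ e) (y ^ k)) ⟩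
    + (y ℕ.* (x ^ suc e ℕ.* y ^ k))                 ≡⟨ cong (λ i → + (y ℕ.* (x ^ i ℕ.* y ^ k))) (ℕₚ.+-∸-assoc 1 k<n) ⟨
    + (y ℕ.* (x ^ (n ∸ k) ℕ.* y ^ k))               ≡⟨ ℤₚ.pos-* y _ ⟩
    + y * d k                                       ∎
    where
    open ≡-Reasoning
    e = n ∸ suc k
    exchange : ∀ x y a b → x ℕ.* (a ℕ.* (y ℕ.* b)) ≡ y ℕ.* (x ℕ.* a ℕ.* b)
    exchange = ℕ-Solver.solve-∀

  gArc-forward : ∀ k f → f ≤ x → gArc (suc k) f ≡ + f * d (suc k)
  gArc-forward k zero    _     = refl
  gArc-forward k (suc f) 1+f≤x with f <? x
  ... | no  f≮x = contradiction 1+f≤x f≮x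
  ... | yes _   = begin
    gArc (suc k) f + (h (suc (suc k)) - h (suc k)) ≡⟨ cong₂ _+_ (gArc-forward k f (ℕₚ.<⇒≤ 1+f≤x)) (ascent (h (suc k)) (d (suc k))) ⟩
    + f * d (suc k) + d (suc k)                    ≡⟨ ℤₚ.+-comm (+ f * d (suc k)) _ ⟩
    d (suc k) + + f * d (suc k)                    ≡⟨ ℤₚ.suc-* (+ f) (d (suc k)) ⟨
    + suc f * d (suc k)                            ∎
    where
    open ≡-Reasoning
    ascent : ∀ a b → a + b - a ≡ b
    ascent = solve-∀

  gArc-backward : ∀ k t → gArc (suc k) (x ℕ.+ t) ≡ + x * d (suc k) - + t * d k
  gArc-backward k zero rewrite ℕₚ.+-identityʳ x =
    trans (gArc-forward k x ℕₚ.≤-refl) (sym (ℤₚ.+-identityʳ _))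
  gArc-backward k (suc t) rewrite ℕₚ.+-suc x t with x ℕ.+ t <? x
  ... | yes x+t<x = contradiction x+t<x (ℕₚ.m+n≮m x t)
  ... | no  _     = begin
    gArc (suc k) (x ℕ.+ t) + (h k - h (suc k))     ≡⟨ cong₂ _+_ (gArc-backward k t) (descent (h k) (d k)) ⟩
    + x * d (suc k) - + t * d k + - d k            ≡⟨ step (+ x * d (suc k)) (+ t) (d k) ⟩
    + x * d (suc k) - (d k + + t * d k)            ≡⟨ cong (λ e → + x * d (suc k) - e) (ℤₚ.suc-* (+ t) (d k)) ⟨
    + x * d (suc k) - + suc t * d k                ∎
    where
    open ≡-Reasoning
    descent : ∀ a b → a - (a + b) ≡ - b
    descent = solve-∀
    step : ∀ a t b → a - t * b + - b ≡ a - (b + t * b)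
    step = solve-∀

  moveWeight : ℕ → Move → ℤ
  moveWeight k (fwd f) = + f * d (suc k)
  moveWeight k (bwd b) = + b * d k

  -- bwd 0 weighs nothing, like the first arc.
  arcIndex : Move → ℕ
  arcIndex (fwd f)       = f
  arcIndex (bwd zero)    = 0
  arcIndex (bwd (suc b)) = x ℕ.+ (y ∸ suc b)

  arcIndex-bwd : ∀ {b} → 0 < b → arcIndex (bwd b) ≡ x ℕ.+ (y ∸ b)
  arcIndex-bwd {suc b} _ = refl

  arcIndex-< : ∀ {m} → ValidMove m → arcIndex m < x ℕ.+ y
  arcIndex-< {fwd f}       f≤x = ℕₚ.≤-<-trans f≤x (ℕₚ.m<m+n x 0<y)
  arcIndex-< {bwd zero}    _   = ℕₚ.<-≤-trans 0<y (ℕₚ.m≤n+m y x)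
  arcIndex-< {bwd (suc b)} b<y = ℕₚ.+-monoʳ-< x (ℕₚ.∸-monoʳ-< (s≤s z≤n) (ℕₚ.<⇒≤ b<y))

  gArc-arcIndex : ∀ {k} m → k < n → ValidMove m → gArc (suc k) (arcIndex m) ≡ moveWeight k m
  gArc-arcIndex {k} (fwd f)       _   f≤x = gArc-forward k f f≤x
  gArc-arcIndex     (bwd zero)    _   _   = refl
  gArc-arcIndex {k} (bwd (suc b)) k<n b<y = begin
    gArc (suc k) (x ℕ.+ (y ∸ suc b))             ≡⟨ gArc-backward k (y ∸ suc b) ⟩
    + x * d (suc k) - + (y ∸ suc b) * d k        ≡⟨ cong (_- + (y ∸ suc b) * d k) (x*d[1+k]≡y*d[k] k<n) ⟩
    + y * d k - + (y ∸ suc b) * d k              ≡⟨ cong (λ i → + i * d k - + (y ∸ suc b) * d k) (ℕₚ.m∸n+n≡m (ℕₚ.<⇒≤ b<y)) ⟨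
    (+ (y ∸ suc b) + + suc b) * d k - + (y ∸ suc b) * d k ≡⟨ cancel (+ (y ∸ suc b)) (+ suc b) (d k) ⟩
    + suc b * d k                                ∎
    where
    open ≡-Reasoning
    cancel : ∀ r b D → (r + b) * D - r * D ≡ b * D
    cancel = solve-∀

  backward-offset : ∀ {j} → j < x ℕ.+ y → x < j → 0 < j ∸ x × j ∸ x < y
  backward-offset {j} j<x+y x<j =
    ℕₚ.m<n⇒0<n∸m x<j , subst (j ∸ x <_) (ℕₚ.m+n∸m≡n x y) (ℕₚ.∸-monoˡ-< j<x+y (ℕₚ.<⇒≤ x<j))

  moveOf : ℕ → Move
  moveOf j with j ≤? x
  ... | yes _ = fwd j
  ... | no  _ = bwd (y ∸ (j ∸ x))

  moveOf-valid : ∀ j → j < x ℕ.+ y → ValidMove (moveOf j)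
  moveOf-valid j j<x+y with j ≤? x
  ... | yes j≤x = j≤x
  ... | no  j≰x with 0<t , t<y ← backward-offset j<x+y (ℕₚ.≰⇒> j≰x) =
    ℕₚ.∸-monoʳ-< 0<t (ℕₚ.<⇒≤ t<y)

  arcIndex-moveOf : ∀ j → j < x ℕ.+ y → arcIndex (moveOf j) ≡ j
  arcIndex-moveOf j j<x+y with j ≤? x
  ... | yes _   = refl
  ... | no  j≰x with 0<t , t<y ← backward-offset j<x+y (ℕₚ.≰⇒> j≰x) = begin
    arcIndex (bwd (y ∸ (j ∸ x)))  ≡⟨ arcIndex-bwd (ℕₚ.m<n⇒0<n∸m t<y) ⟩
    x ℕ.+ (y ∸ (y ∸ (j ∸ x)))     ≡⟨ cong (x ℕ.+_) (ℕₚ.m∸[m∸n]≡n (ℕₚ.<⇒≤ t<y)) ⟩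
    x ℕ.+ (j ∸ x)                 ≡⟨ ℕₚ.m+[n∸m]≡n (ℕₚ.<⇒≤ (ℕₚ.≰⇒> j≰x)) ⟩
    j                             ∎
    where open ≡-Reasoning

  arcsWeight : ℕ → List ℕ → ℤ
  arcsWeight = sumFrom (λ k j → gArc (suc k) j)

  movesWeight : ℕ → List Move → ℤ
  movesWeight = sumFrom moveWeight

  weigh : ℕ → List ℤ → ℤ
  weigh = sumFrom (λ k a → a * d k)

  level-< : ∀ {k l} → k ℕ.+ suc l ≤ n → k < n
  level-< {k} le = ℕₚ.<-≤-trans (ℕₚ.m<m+n k (s≤s z≤n)) le

  level-suc : ∀ {k l} → k ℕ.+ suc l ≤ n → suc k ℕ.+ l ≤ n
  level-suc {k} {l} = subst (_≤ n) (ℕₚ.+-suc k l)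

  gRotor≡arcsWeight : ∀ ρ → gRotor ρ ≡ arcsWeight 0 (tabulate (toℕ ∘ ρ))
  gRotor≡arcsWeight ρ = sumFin-tabulate n (λ k j → gArc (suc k) j) (toℕ ∘ ρ)

  arcsWeight-arcIndex : ∀ k ms → k ℕ.+ length ms ≤ n → All ValidMove ms →
                        arcsWeight k (map arcIndex ms) ≡ movesWeight k ms
  arcsWeight-arcIndex k []       _  []          = refl
  arcsWeight-arcIndex k (m ∷ ms) le (vm ∷ vms) =
    cong₂ _+_ (gArc-arcIndex m (level-< le) vm) (arcsWeight-arcIndex (suc k) ms (level-suc le) vms)

  digits-value : ∀ k u ms → k ℕ.+ length ms ≤ n →
                 + u * d k + movesWeight k ms ≡ weigh k (digits u ms)
  digits-value k u []           _  = refl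
  digits-value k u (fwd f ∷ ms) le = cong (_+_ (+ u * d k)) (digits-value (suc k) f ms (level-suc le))
  digits-value k u (bwd b ∷ ms) le with y ≤? u ℕ.+ b
  ... | yes y≤u+b = begin
    + u * d k + (+ b * d k + M)                  ≡⟨ regroup (+ (u ℕ.+ b ∸ y)) (+ y) (+ u) (+ b) (d k) M (cong +_ (ℕₚ.m∸n+n≡m y≤u+b)) ⟨
    + (u ℕ.+ b ∸ y) * d k + (+ y * d k + M)      ≡⟨ cong (λ e → + (u ℕ.+ b ∸ y) * d k + (e + M)) (x*d[1+k]≡y*d[k] (level-< le)) ⟨
    + (u ℕ.+ b ∸ y) * d k + (+ x * d (suc k) + M) ≡⟨ cong (_+_ (+ (u ℕ.+ b ∸ y) * d k)) (digits-value (suc k) x ms (level-suc le)) ⟩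
    weigh k (+ (u ℕ.+ b ∸ y) ∷ digits x ms)      ∎
    where
    open ≡-Reasoning
    M = movesWeight (suc k) ms
  ... | no _ = trans (regroup (+ u) (+ b) (+ (u ℕ.+ b)) 0ℤ (d k) M (sym (ℤₚ.+-identityʳ (+ (u ℕ.+ b)))))
                     (cong (_+_ (+ (u ℕ.+ b) * d k)) (digits-value (suc k) 0 ms (level-suc le)))
    where M = movesWeight (suc k) ms

  weigh-horner : ∀ k w m → k ℕ.+ length w ≡ suc n →
                 weigh k w + m * + (y ^ suc n) ≡ + (y ^ k) * horner x y w m
  weigh-horner k []      m k+0≡ = begin
    0ℤ + m * + (y ^ suc n)  ≡⟨ ℤₚ.+-identityˡ _ ⟩
    m * + (y ^ suc n)       ≡⟨ cong (λ i → m * + (y ^ i)) (trans (sym (ℕₚ.+-identityʳ k)) k+0≡) ⟨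
    m * + (y ^ k)           ≡⟨ ℤₚ.*-comm m _ ⟩
    + (y ^ k) * m           ∎
    where open ≡-Reasoning
  weigh-horner k (a ∷ w) m len = begin
    a * d k + weigh (suc k) w + Top                        ≡⟨ ℤₚ.+-assoc (a * d k) _ Top ⟩
    a * d k + (weigh (suc k) w + Top)                      ≡⟨ cong₂ (λ e f → a * e + f) d-split (weigh-horner (suc k) w m len′) ⟩
    a * (X * + (y ^ k)) + + (y ^ suc k) * H                ≡⟨ cong (λ e → a * (X * + (y ^ k)) + e * H) (ℤₚ.pos-* y (y ^ k)) ⟩
    a * (X * + (y ^ k)) + + y * + (y ^ k) * H              ≡⟨ factor a X (+ y) (+ (y ^ k)) H ⟩
    + (y ^ k) * (a * X + + y * H)                          ∎
    where
    open ≡-Reasoning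
    Top = m * + (y ^ suc n)
    X = + (x ^ length w)
    H = horner x y w m
    len′ : suc k ℕ.+ length w ≡ suc n
    len′ = trans (sym (ℕₚ.+-suc k (length w))) len
    n∸k≡ : n ∸ k ≡ length w
    n∸k≡ = trans (cong (_∸ k) (sym (ℕₚ.suc-injective len′))) (ℕₚ.m+n∸m≡n k (length w))
    d-split : d k ≡ X * + (y ^ k)
    d-split = trans (cong (λ i → + (x ^ i ℕ.* y ^ k)) n∸k≡) (ℤₚ.pos-* (x ^ length w) (y ^ k))
    factor : ∀ a X y Y H → a * (X * Y) + y * Y * H ≡ Y * (a * X + y * H)
    factor = solve-∀

  weigh≡horner : ∀ w m → length w ≡ suc n → weigh 0 w + m * + (y ^ suc n) ≡ horner x y w m
  weigh≡horner w m len = trans (weigh-horner 0 w m len) (ℤₚ.*-identityˡ _)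

  moves⇒realisable : ∀ ms → All ValidMove ms → length ms ≡ n →
                     ∃ λ ρ → gRotor ρ ≡ movesWeight 0 ms
  moves⇒realisable ms vms len
    with ρ , arcs≡ ← tabulate-toℕ-surjective (map arcIndex ms) (Allₚ.map⁺ (All.map arcIndex-< vms))
                       (trans (Listₚ.length-map arcIndex ms) len)
    = ρ , (begin
      gRotor ρ                          ≡⟨ gRotor≡arcsWeight ρ ⟩
      arcsWeight 0 (tabulate (toℕ ∘ ρ)) ≡⟨ cong (arcsWeight 0) arcs≡ ⟩
      arcsWeight 0 (map arcIndex ms)    ≡⟨ arcsWeight-arcIndex 0 ms (ℕₚ.≤-reflexive len) vms ⟩
      movesWeight 0 ms                  ∎)
    where open ≡-Reasoning

  admissibleMoves : List ℤ → List ℤ → List Move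
  admissibleMoves A B = map (bwd ∘ ∣_∣) A ++ map (fwd ∘ ∣_∣) B

  admissibleMoves-valid : ∀ {A B} → All (Digit y) A → All (Low x) B → All ValidMove (admissibleMoves A B)
  admissibleMoves-valid dA lB =
    Allₚ.++⁺ (Allₚ.map⁺ (All.map (∣digit∣<base 0<y) dA)) (Allₚ.map⁺ (All.map ∣low∣≤x lB))
    where
    ∣low∣≤x : ∀ {b} → Low x b → ∣ b ∣ ≤ x
    ∣low∣≤x (ℤ.+≤+ _ , ℤ.+≤+ b≤x) = b≤x

  length-admissibleMoves : ∀ A B → suc (length (admissibleMoves A B)) ≡ length (A ++ 0ℤ ∷ B)
  length-admissibleMoves A B = begin
    suc (length (admissibleMoves A B))   ≡⟨ cong suc (Listₚ.length-++ (map (bwd ∘ ∣_∣) A)) ⟩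
    suc (length (map (bwd ∘ ∣_∣) A) ℕ.+ length (map (fwd ∘ ∣_∣) B))
      ≡⟨ cong₂ (λ p q → suc (p ℕ.+ q)) (Listₚ.length-map _ A) (Listₚ.length-map _ B) ⟩
    suc (length A ℕ.+ length B)          ≡⟨ ℕₚ.+-suc (length A) (length B) ⟨
    length A ℕ.+ suc (length B)          ≡⟨ Listₚ.length-++ A ⟨
    length (A ++ 0ℤ ∷ B)                 ∎
    where open ≡-Reasoning

  forward-weight : ∀ k B → All (Low x) B → movesWeight k (map (fwd ∘ ∣_∣) B) ≡ weigh (suc k) B
  forward-weight k []      []              = refl
  forward-weight k (b ∷ B) ((1≤b , _) ∷ lB) =
    cong₂ _+_ (cong (_* d (suc k)) (ℤₚ.0≤i⇒+∣i∣≡i (ℤₚ.≤-trans (ℤ.+≤+ z≤n) 1≤b)))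
              (forward-weight (suc k) B lB)

  admissibleMoves-weight : ∀ k A B → All (Digit y) A → All (Low x) B →
                           movesWeight k (admissibleMoves A B) ≡ weigh k (A ++ 0ℤ ∷ B)
  admissibleMoves-weight k []      B []              lB =
    trans (forward-weight k B lB) (sym (ℤₚ.+-identityˡ _))
  admissibleMoves-weight k (a ∷ A) B ((0≤a , _) ∷ dA) lB =
    cong₂ _+_ (cong (_* d k) (ℤₚ.0≤i⇒+∣i∣≡i 0≤a)) (admissibleMoves-weight (suc k) A B dA lB)

  admissible⇒realisable : ∀ {w} → Admissible w → length w ≡ suc n → ∃ λ ρ → gRotor ρ ≡ weigh 0 w
  admissible⇒realisable (A , B , refl , dA , lB) len
    with ρ , gρ ← moves⇒realisable (admissibleMoves A B) (admissibleMoves-valid dA lB)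
                    (ℕₚ.suc-injective (trans (length-admissibleMoves A B) len))
    = ρ , trans gρ (admissibleMoves-weight 0 A B dA lB)

  rotorMoves : RotorConfig → List Move
  rotorMoves ρ = map moveOf (tabulate (toℕ ∘ ρ))

  rotorMoves-valid : ∀ ρ → All ValidMove (rotorMoves ρ)
  rotorMoves-valid ρ = Allₚ.map⁺ (Allₚ.tabulate⁺ (λ i → moveOf-valid _ (Finₚ.toℕ<n (ρ i))))

  length-rotorMoves : ∀ ρ → length (rotorMoves ρ) ≡ n
  length-rotorMoves ρ = trans (Listₚ.length-map moveOf (tabulate (toℕ ∘ ρ))) (Listₚ.length-tabulate (toℕ ∘ ρ))

  gRotor≡movesWeight : ∀ ρ → gRotor ρ ≡ movesWeight 0 (rotorMoves ρ)
  gRotor≡movesWeight ρ = begin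
    gRotor ρ                                 ≡⟨ gRotor≡arcsWeight ρ ⟩
    arcsWeight 0 (tabulate (toℕ ∘ ρ))        ≡⟨ cong (arcsWeight 0) arcs≡ ⟨
    arcsWeight 0 (map arcIndex (rotorMoves ρ)) ≡⟨ arcsWeight-arcIndex 0 (rotorMoves ρ)
                                                 (ℕₚ.≤-reflexive (length-rotorMoves ρ)) (rotorMoves-valid ρ) ⟩
    movesWeight 0 (rotorMoves ρ)             ∎
    where
    open ≡-Reasoning
    arcs≡ : map arcIndex (rotorMoves ρ) ≡ tabulate (toℕ ∘ ρ)
    arcs≡ = trans (sym (Listₚ.map-∘ (tabulate (toℕ ∘ ρ))))
      (Listₚ.map-id-local (Allₚ.tabulate⁺ (λ i → arcIndex-moveOf _ (Finₚ.toℕ<n (ρ i)))))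

  rotorDigits : RotorConfig → List ℤ
  rotorDigits ρ = digits 0 (rotorMoves ρ)

  length-rotorDigits : ∀ ρ → length (rotorDigits ρ) ≡ suc n
  length-rotorDigits ρ = trans (length-digits 0 (rotorMoves ρ)) (cong suc (length-rotorMoves ρ))

  gRotor≡horner-rotorDigits : ∀ ρ → gRotor ρ ≡ horner x y (rotorDigits ρ) 0ℤ
  gRotor≡horner-rotorDigits ρ = begin
    gRotor ρ                           ≡⟨ gRotor≡movesWeight ρ ⟩
    movesWeight 0 (rotorMoves ρ)       ≡⟨ ℤₚ.+-identityˡ _ ⟨
    0ℤ + movesWeight 0 (rotorMoves ρ)  ≡⟨ digits-value 0 0 (rotorMoves ρ) (ℕₚ.≤-reflexive (length-rotorMoves ρ)) ⟩
    weigh 0 (rotorDigits ρ)            ≡⟨ ℤₚ.+-identityʳ _ ⟨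
    weigh 0 (rotorDigits ρ) + 0ℤ       ≡⟨ weigh≡horner (rotorDigits ρ) 0ℤ (length-rotorDigits ρ) ⟩
    horner x y (rotorDigits ρ) 0ℤ      ∎
    where open ≡-Reasoning

  InGR-horner⇔ : Coprime x y → ∀ w m → length w ≡ suc n → All (Digit y) w →
                 InGR (horner x y w m) ⇔ (m ≡ 0ℤ × Admissible w)
  InGR-horner⇔ x⊥y w m len dw = mk⇔ to from
    where
    to : InGR (horner x y w m) → m ≡ 0ℤ × Admissible w
    to (ρ , gρ≡)
      with w≡ , m≡0 ← horner-injective (Coprimality.sym x⊥y) 0<y w (rotorDigits ρ)
                         (trans len (sym (length-rotorDigits ρ)))
                         dw (admissible⇒digits (digits-admissible _ (rotorMoves-valid ρ)))
                         (trans (sym gρ≡) (gRotor≡horner-rotorDigits ρ))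
      = m≡0 , subst Admissible (sym w≡) (digits-admissible _ (rotorMoves-valid ρ))
    from : m ≡ 0ℤ × Admissible w → InGR (horner x y w m)
    from (refl , adm) with ρ , gρ ← admissible⇒realisable adm len =
      ρ , trans gρ (trans (sym (ℤₚ.+-identityʳ _)) (weigh≡horner w 0ℤ len))

  stableDecomp⇒horner : ∀ {v} (w : Vec ℤ (suc n)) a → IsStableDecomp v (w ∷ʳ a) →
    All (Digit y) (toList w) × ∃ λ m → a ≡ + x * m × v ≡ horner x y (toList w) m
  stableDecomp⇒horner w a (bounds , m , last≡ , v≡) =
    digits-w , m , trans (sym (lookup-∷ʳ-fromℕ w a)) last≡ , trans v≡ value
    where
    open ≡-Reasoning
    Top = m * + (y ^ suc n)
    digits-w : All (Digit y) (toList w)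
    digits-w = subst (All (Digit y)) (sym (toList≡tabulate-lookup w))
      (Allₚ.tabulate⁺ (λ k → subst (Digit y) (lookup-∷ʳ-inject₁ w a k) (bounds k)))
    value : sumFin (suc n) (λ k → lookup (w ∷ʳ a) (inject₁ k) * d (toℕ k)) + Top ≡ horner x y (toList w) m
    value = begin
      sumFin (suc n) (λ k → lookup (w ∷ʳ a) (inject₁ k) * d (toℕ k)) + Top
        ≡⟨ cong (_+ Top) (sumFin-cong (suc n) (λ k → cong (_* d (toℕ k)) (lookup-∷ʳ-inject₁ w a k))) ⟩
      sumFin (suc n) (λ k → lookup w k * d (toℕ k)) + Top
        ≡⟨ cong (_+ Top) (sumFin-tabulate (suc n) (λ k a → a * d k) (lookup w)) ⟩
      weigh 0 (tabulate (lookup w)) + Top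
        ≡⟨ cong (λ u → weigh 0 u + Top) (toList≡tabulate-lookup w) ⟨
      weigh 0 (toList w) + Top
        ≡⟨ weigh≡horner (toList w) m (Vecₚ.length-toList w) ⟩
      horner x y (toList w) m ∎

theorem8 : (n x y : ℕ) → 1 ≤ n → Coprime x y → 1 ≤ x → x < y →
    (v : ℕ) → (c : Vec ℤ (2 Data.Nat.+ n)) → RotorPath.IsStableDecomp n x y (+ v) c →
    (RotorPath.InGR n x y (+ v) ⇔ RotorPath.InLanguage n x y c)
theorem8 n x y _ x⊥y 1≤x x<y v c stable with initLast c
... | w , a , refl with dw , m , a≡xm , v≡ ← Rotor.stableDecomp⇒horner n x y x<y w a stable = begin
  InGR (+ v)                              ≡⟨ cong InGR v≡ ⟩
  InGR (horner x y (toList w) m)          ≈⟨ InGR-horner⇔ x⊥y (toList w) m (Vecₚ.length-toList w) dw ⟩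
  (m ≡ 0ℤ × Admissible (toList w))        ≈⟨ m≡0⇔a≡0 ×-⇔ Equivalence.refl ⟩
  (a ≡ 0ℤ × Admissible (toList w))        ≈⟨ Equivalence.sym (∷ʳ-∈e_d⇔ n (toList w) a) ⟩
  toList w List.∷ʳ a ∈ e_d                ≡⟨ cong (_∈ e_d) (Vecₚ.toList-∷ʳ a w) ⟨
  InLanguage (w ∷ʳ a)                     ∎
  where
  open RotorPath n x y
  open Words x<y
  open Rotor n x y x<y
  open Regex using (_∈_)
  open SetoidReasoning (Equivalence.⇔-setoid 0ℓ)
  m≡0⇔a≡0 : m ≡ 0ℤ ⇔ a ≡ 0ℤ
  m≡0⇔a≡0 = mk⇔ (λ { refl → trans a≡xm (ℤₚ.*-zeroʳ (+ x)) })
    (λ a≡0 → ℤₚ.*-cancelˡ-≡ (+ x) m 0ℤ {{ℕ.>-nonZero 1≤x}} (trans (sym a≡xm) (trans a≡0 (sym (ℤₚ.*-zeroʳ (+ x))))))
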